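{- Let $[n]=E_1\sqcup\cdots\sqcup E_r$ be a partition into nonempty blocks with $\max E_i<\min E_{i+1}$ for $i=1,\dots,r-1$, and let $f:\{1,\dots,r\}\to\{2,3,\dots\}$ be a nondecreasing map. Let $\Delta$ be the simplicial complex on $[n]$ whose facets are exactly the subsets $F\subseteq[n]$ such that (1) $|E_i\setminus F|\le 1$ for all $i=1,\dots,r$, and (2) if $\min([n]\setminus F)\in E_i$, then $|F|=n-f(i)$. Then $\Delta$ is shellable.
   Context: A simplicial complex is shellable if its facets can be linearly ordered $F_1,\dots,F_q$ so that for each $k=2,\dots,q$ the complex $\big(\bigcup_{i<k}2^{F_i}\big)\cap 2^{F_k}$ is pure of dimension $\dim F_k-1$, where $2^F$ denotes the set of all subsets of $F$. -}

module Defs where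

open import Data.Nat as ℕ using (ℕ; suc; _+_)
open import Data.Fin as Fin using (Fin; toℕ)
open import Data.Fin.Subset using (Subset; _∈_; _∉_; _⊆_; _∩_; ∁; ∣_∣; Nonempty)
open import Data.List using (List; length; lookup)
open import Data.List.Relation.Unary.Unique.Propositional using (Unique)
import Data.List.Membership.Propositional as LMem
open import Data.Product using (Σ; ∃; _×_)
open import Function.Bundles using (_⇔_)
open import Relation.Binary.PropositionalEquality using (_≡_)

Complex : ℕ → Set₁
Complex n = Subset n → Set

IsFacetOf : ∀ {n} → Complex n → Subset n → Set
IsFacetOf Δ F = Δ F × (∀ G → Δ G → F ⊆ G → G ≡ F)

Generated : ∀ {n} → (Subset n → Set) → Complex n
Generated P G = ∃ λ F → P F × G ⊆ F

-- "K is pure of dimension dim F - 1" where s = |F|: K is nonempty and every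
-- facet G of K has |G| - 1 = |F| - 2, stated as |G| + 1 ≡ |F|.
PureOfFaceSize : ∀ {n} → Complex n → ℕ → Set
PureOfFaceSize K s = (∃ λ G → K G) × (∀ G → IsFacetOf K G → ∣ G ∣ + 1 ≡ s)

Prefix∩ : ∀ {n} (Fs : List (Subset n)) → Fin (length Fs) → Complex n
Prefix∩ Fs k G = G ⊆ lookup Fs k × (∃ λ j → (toℕ j ℕ.< toℕ k) × G ⊆ lookup Fs j)

-- The shelling condition on an ordered list of facets (0-indexed; the
-- condition is imposed for every position k ≥ 1, i.e. k = 2,…,q in the paper).
IsShellingOrder : ∀ {n} → List (Subset n) → Set
IsShellingOrder Fs =
  ∀ (k : Fin (length Fs)) → 1 ℕ.≤ toℕ k →
    PureOfFaceSize (Prefix∩ Fs k) ∣ lookup Fs k ∣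

Shellable : ∀ {n} → Complex n → Set
Shellable {n} Δ = Σ (List (Subset n)) λ Fs →
  Unique Fs × (∀ F → (F LMem.∈ Fs) ⇔ IsFacetOf Δ F) × IsShellingOrder Fs

IsOrderedPartition : ∀ {n r} → (Fin r → Subset n) → Set
IsOrderedPartition {n} {r} E =
  (∀ i → Nonempty (E i)) ×
  (∀ (x : Fin n) → ∃ λ i → x ∈ E i) ×
  (∀ (x : Fin n) i j → x ∈ E i → x ∈ E j → i ≡ j) ×
  (∀ (i j : Fin r) → toℕ j ≡ suc (toℕ i) →
     ∀ x y → x ∈ E i → y ∈ E j → x Fin.< y)

IsMinOfComplement : ∀ {n} → Subset n → Fin n → Set
IsMinOfComplement F x = x ∉ F × (∀ y → y Fin.< x → y ∈ F)

-- The sets F ⊆ [n] with (1) |E_i ∖ F| ≤ 1 for all i and (2) if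
-- min([n] ∖ F) ∈ E_i then |F| = n - f(i)  (written |F| + f(i) = n;
-- the minimum is required to exist, i.e. F ≠ [n]).
IsDeltaFacet : ∀ {n r} → (Fin r → Subset n) → (Fin r → ℕ) → Subset n → Set
IsDeltaFacet {n} E f F =
  (∀ i → ∣ E i ∩ ∁ F ∣ ℕ.≤ 1) ×
  (∃ λ x → x ∉ F) ×
  (∀ x i → IsMinOfComplement F x → x ∈ E i → ∣ F ∣ + f i ≡ n)

Δ : ∀ {n r} → (Fin r → Subset n) → (Fin r → ℕ) → Complex n
Δ E f = Generated (IsDeltaFacet E f)

module Submission where

-- Order the facets lexicographically, comparing them at the first vertex where they differ.
-- If F_j precedes F_k and x is that vertex (x ∉ F_j, x ∈ F_k), take for the complement of a
-- new facet G the |∁ F_j| smallest elements of (∁ F_k ∖ E_b) ∪ {x}, where E_b is the block of x.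
-- Below x this agrees with ∁ F_j, so G has the same least non-element as F_j, hence the right size;
-- there are enough elements because f is nondecreasing, and removing E_b keeps one element per
-- block.  Then G precedes F_k and F_k ∖ {x} ⊆ G, which is the classical criterion for a shelling.

open import Defs
open import Data.Nat using (ℕ; _≤_)
open import Data.Fin using (Fin)
open import Data.Fin.Subset using (Subset)

open import Data.Bool.Properties using (not-involutive)
open import Data.Empty using (⊥-elim)
open import Data.Fin as Fin using (zero; suc; toℕ)
import Data.Fin.Properties as FinP
open import Data.Fin.Subset
open import Data.Fin.Subset.Properties
open import Data.List using (List; map; _++_; [_]; lookup; length; filter)
import Data.List.Relation.Unary.All as All
import Data.List.Relation.Unary.All.Properties as AllP
open import Data.List.Relation.Unary.AllPairs as AllPairs using (AllPairs)
import Data.List.Relation.Unary.AllPairs.Properties as AllPairsP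
open import Data.List.Relation.Unary.Any using (index) renaming (here to hereₗ)
open import Data.List.Relation.Unary.Any.Properties using (lookup-index)
import Data.List.Membership.Propositional as Mem
open import Data.List.Membership.Propositional.Properties
  using (∈-map⁺; ∈-++⁺ˡ; ∈-++⁺ʳ; ∈-lookup; ∈-filter⁺; ∈-filter⁻)
open import Data.Nat as ℕ using (zero; suc; _+_; _<_; z≤n; s≤s)
import Data.Nat.Properties as ℕP
open import Data.Product using (∃; _×_; _,_; proj₁; proj₂)
open import Data.Sum using (_⊎_; inj₁; inj₂)
open import Data.Vec using (_∷_; []; here; there)
open import Function.Base using (_∘_)
open import Function.Bundles using (_⇔_; mk⇔; Equivalence)
import Function.Properties.Equivalence as ⇔
open import Relation.Binary using (tri<; tri≈; tri>)
open import Relation.Binary.Definitions using (Asymmetric)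
open import Relation.Binary.PropositionalEquality
  using (_≡_; refl; sym; trans; cong; cong₂; subst; module ≡-Reasoning)
open import Relation.Nullary using (¬_; yes; no)
open import Relation.Nullary.Decidable using (Dec; ¬?; _×-dec_; _→-dec_)

open Equivalence using (to; from)

-- Finite subsets

∁-involutive : ∀ {n} (p : Subset n) → ∁ (∁ p) ≡ p
∁-involutive []      = refl
∁-involutive (b ∷ p) = cong₂ _∷_ (not-involutive b) (∁-involutive p)

∣p∣+∣∁p∣≡n : ∀ {n} (p : Subset n) → ∣ p ∣ + ∣ ∁ p ∣ ≡ n
∣p∣+∣∁p∣≡n p = trans (cong (∣ p ∣ +_) (∣∁p∣≡n∸∣p∣ p)) (ℕP.m+[n∸m]≡n (∣p∣≤n p))

∣p∣≡∣p∩q∣+∣p─q∣ : ∀ {n} (p q : Subset n) → ∣ p ∣ ≡ ∣ p ∩ q ∣ + ∣ p ─ q ∣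
∣p∣≡∣p∩q∣+∣p─q∣ []            []            = refl
∣p∣≡∣p∩q∣+∣p─q∣ (inside  ∷ p) (inside  ∷ q) = cong suc (∣p∣≡∣p∩q∣+∣p─q∣ p q)
∣p∣≡∣p∩q∣+∣p─q∣ (inside  ∷ p) (outside ∷ q) =
  trans (cong suc (∣p∣≡∣p∩q∣+∣p─q∣ p q)) (sym (ℕP.+-suc _ _))
∣p∣≡∣p∩q∣+∣p─q∣ (outside ∷ p) (inside  ∷ q) = ∣p∣≡∣p∩q∣+∣p─q∣ p q
∣p∣≡∣p∩q∣+∣p─q∣ (outside ∷ p) (outside ∷ q) = ∣p∣≡∣p∩q∣+∣p─q∣ p q

x∈p─q⇒x∉q : ∀ {n} {p q : Subset n} {x} → x ∈ p ─ q → x ∉ q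
x∈p─q⇒x∉q {p = inside ∷ p} {outside ∷ q} here ()
x∈p─q⇒x∉q {p = _ ∷ p} {_ ∷ q} (there x∈p─q) (there x∈q) = x∈p─q⇒x∉q x∈p─q x∈q

x∈p⇒∣p∣≡1+∣p-x∣ : ∀ {n} {p : Subset n} {x} → x ∈ p → ∣ p ∣ ≡ suc ∣ p - x ∣
x∈p⇒∣p∣≡1+∣p-x∣ {p = p} {x} x∈p = begin
  ∣ p ∣                       ≡⟨ ∣p∣≡∣p∩q∣+∣p─q∣ p ⁅ x ⁆ ⟩
  ∣ p ∩ ⁅ x ⁆ ∣ + ∣ p - x ∣   ≡⟨ cong (λ q → ∣ q ∣ + ∣ p - x ∣) p∩⁅x⁆≡⁅x⁆ ⟩
  ∣ ⁅ x ⁆ ∣ + ∣ p - x ∣       ≡⟨ cong (_+ ∣ p - x ∣) (∣⁅x⁆∣≡1 x) ⟩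
  suc ∣ p - x ∣               ∎
  where
  open ≡-Reasoning
  p∩⁅x⁆≡⁅x⁆ : p ∩ ⁅ x ⁆ ≡ ⁅ x ⁆
  p∩⁅x⁆≡⁅x⁆ = ⊆-antisym (p∩q⊆q p ⁅ x ⁆)
    (λ y∈⁅x⁆ → x∈p∩q⁺ (subst (_∈ p) (sym (x∈⁅y⁆⇒x≡y x y∈⁅x⁆)) x∈p , y∈⁅x⁆))

∣p∣≤1⇒x≡y : ∀ {n} {p : Subset n} {x y} → ∣ p ∣ ≤ 1 → x ∈ p → y ∈ p → x ≡ y
∣p∣≤1⇒x≡y {p = p} {x} {y} ∣p∣≤1 x∈p y∈p with x FinP.≟ y
... | yes x≡y = x≡y
... | no  x≢y = ⊥-elim (ℕP.<-irrefl refl (begin-strict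
  1                 ≡⟨ sym (∣⁅x⁆∣≡1 x) ⟩
  ∣ ⁅ x ⁆ ∣         ≤⟨ p⊆q⇒∣p∣≤∣q∣ ⁅x⁆⊆p-y ⟩
  ∣ p - y ∣         <⟨ ℕP.n<1+n _ ⟩
  suc ∣ p - y ∣     ≡⟨ sym (x∈p⇒∣p∣≡1+∣p-x∣ y∈p) ⟩
  ∣ p ∣             ≤⟨ ∣p∣≤1 ⟩
  1                 ∎))
  where
  open ℕP.≤-Reasoning
  ⁅x⁆⊆p-y : ⁅ x ⁆ ⊆ p - y
  ⁅x⁆⊆p-y z∈⁅x⁆ with x∈⁅y⁆⇒x≡y x z∈⁅x⁆
  ... | refl = x∈p∧x≢y⇒x∈p-y x∈p x≢y

p⊆q∧∣q∣≤∣p∣⇒p≡q : ∀ {n} {p q : Subset n} → p ⊆ q → ∣ q ∣ ≤ ∣ p ∣ → p ≡ q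
p⊆q∧∣q∣≤∣p∣⇒p≡q {p = []}          {[]}          _   _ = refl
p⊆q∧∣q∣≤∣p∣⇒p≡q {p = inside  ∷ p} {inside  ∷ q} p⊆q (s≤s ∣q∣≤∣p∣) =
  cong (inside ∷_) (p⊆q∧∣q∣≤∣p∣⇒p≡q (drop-∷-⊆ p⊆q) ∣q∣≤∣p∣)
p⊆q∧∣q∣≤∣p∣⇒p≡q {p = inside  ∷ p} {outside ∷ q} p⊆q _ with p⊆q here
... | ()
p⊆q∧∣q∣≤∣p∣⇒p≡q {p = outside ∷ p} {inside  ∷ q} p⊆q ∣q∣≤∣p∣ =
  ⊥-elim (ℕP.<⇒≱ (s≤s (p⊆q⇒∣p∣≤∣q∣ (drop-∷-⊆ p⊆q))) ∣q∣≤∣p∣)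
p⊆q∧∣q∣≤∣p∣⇒p≡q {p = outside ∷ p} {outside ∷ q} p⊆q ∣q∣≤∣p∣ =
  cong (outside ∷_) (p⊆q∧∣q∣≤∣p∣⇒p≡q (drop-∷-⊆ p⊆q) ∣q∣≤∣p∣)

∣∁p∣≤∣∁q∣⇒∣q∣≤∣p∣ : ∀ {n} (p q : Subset n) → ∣ ∁ p ∣ ≤ ∣ ∁ q ∣ → ∣ q ∣ ≤ ∣ p ∣
∣∁p∣≤∣∁q∣⇒∣q∣≤∣p∣ {n} p q ∁p≤∁q = ℕP.+-cancelʳ-≤ _ ∣ q ∣ ∣ p ∣ (begin
  ∣ q ∣ + ∣ ∁ q ∣   ≡⟨ ∣p∣+∣∁p∣≡n q ⟩
  n                 ≡⟨ sym (∣p∣+∣∁p∣≡n p) ⟩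
  ∣ p ∣ + ∣ ∁ p ∣   ≤⟨ ℕP.+-monoʳ-≤ ∣ p ∣ ∁p≤∁q ⟩
  ∣ p ∣ + ∣ ∁ q ∣   ∎)
  where open ℕP.≤-Reasoning

minOfComplement-exists : ∀ {n} {p : Subset n} → (∃ λ x → x ∉ p) → ∃ (IsMinOfComplement p)
minOfComplement-exists {p = outside ∷ p} _ = zero , (λ ()) , (λ _ ())
minOfComplement-exists {p = inside ∷ p} (zero , x∉p) = ⊥-elim (x∉p here)
minOfComplement-exists {p = inside ∷ p} (suc x , x∉p)
  with minOfComplement-exists (x , x∉p ∘ there)
... | m , m∉p , below-m = suc m , m∉p ∘ drop-there , below-suc-m
  where
  below-suc-m : ∀ y → y Fin.< suc m → y ∈ inside ∷ p
  below-suc-m zero    _         = here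
  below-suc-m (suc y) (s≤s y<m) = there (below-m y y<m)

minOfComplement-≤ : ∀ {n} {p : Subset n} {m x} → IsMinOfComplement p m → x ∉ p → m Fin.≤ x
minOfComplement-≤ (_ , below-m) x∉p = ℕP.≮⇒≥ (x∉p ∘ below-m _)

minOfComplement-unique : ∀ {n} {p : Subset n} {m m′} →
                         IsMinOfComplement p m → IsMinOfComplement p m′ → m ≡ m′
minOfComplement-unique min-m min-m′ = FinP.≤-antisym
  (minOfComplement-≤ min-m (proj₁ min-m′)) (minOfComplement-≤ min-m′ (proj₁ min-m))

AgreeBelow : ∀ {n} → Fin n → Subset n → Subset n → Set
AgreeBelow x p q = ∀ y → y Fin.< x → y ∈ p ⇔ y ∈ q

agreeBelow-head : ∀ {n a b x} {p q : Subset n} →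
                  AgreeBelow (suc x) (a ∷ p) (b ∷ q) → a ≡ b
agreeBelow-head {a = inside}  {inside}  _  = refl
agreeBelow-head {a = outside} {outside} _  = refl
agreeBelow-head {a = inside}  {outside} ag with to (ag zero (s≤s z≤n)) here
... | ()
agreeBelow-head {a = outside} {inside}  ag with from (ag zero (s≤s z≤n)) here
... | ()

agreeBelow-tail : ∀ {n a b x} {p q : Subset n} →
                  AgreeBelow (suc x) (a ∷ p) (b ∷ q) → AgreeBelow x p q
agreeBelow-tail ag y y<x = mk⇔ (drop-there ∘ to (ag (suc y) (s≤s y<x)) ∘ there)
                               (drop-there ∘ from (ag (suc y) (s≤s y<x)) ∘ there)

agreeBelow-∷ : ∀ {n b x} {p q : Subset n} →
               AgreeBelow x p q → AgreeBelow (suc x) (b ∷ p) (b ∷ q)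
agreeBelow-∷ ag zero    _         = mk⇔ (λ { here → here }) (λ { here → here })
agreeBelow-∷ ag (suc y) (s≤s y<x) = mk⇔ (λ { (there h) → there (to (ag y y<x) h) })
                                        (λ { (there h) → there (from (ag y y<x) h) })

countBelow : ∀ {n} → Fin n → Subset n → ℕ
countBelow zero    _             = 0
countBelow (suc x) (inside  ∷ p) = suc (countBelow x p)
countBelow (suc x) (outside ∷ p) = countBelow x p

countBelow-cong : ∀ {n} {x : Fin n} {p q} → AgreeBelow x p q → countBelow x p ≡ countBelow x q
countBelow-cong {x = zero} _ = refl
countBelow-cong {x = suc x} {inside ∷ p} {b ∷ q} ag with agreeBelow-head ag
... | refl = cong suc (countBelow-cong (agreeBelow-tail ag))
countBelow-cong {x = suc x} {outside ∷ p} {b ∷ q} ag with agreeBelow-head ag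
... | refl = countBelow-cong (agreeBelow-tail ag)

countBelow<∣p∣ : ∀ {n} {x : Fin n} {p} → x ∈ p → countBelow x p < ∣ p ∣
countBelow<∣p∣ {x = zero}  {inside  ∷ p} here        = s≤s z≤n
countBelow<∣p∣ {x = suc x} {inside  ∷ p} (there x∈p) = s≤s (countBelow<∣p∣ x∈p)
countBelow<∣p∣ {x = suc x} {outside ∷ p} (there x∈p) = countBelow<∣p∣ x∈p

smallest : ∀ {n} → ℕ → Subset n → Subset n
smallest zero    _             = ⊥
smallest (suc s) []            = []
smallest (suc s) (outside ∷ p) = outside ∷ smallest (suc s) p
smallest (suc s) (inside  ∷ p) = inside ∷ smallest s p

smallest⊆ : ∀ {n} s (p : Subset n) → smallest s p ⊆ p
smallest⊆ zero    p             = ⊥⊆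
smallest⊆ (suc s) (outside ∷ p) (there y∈) = there (smallest⊆ (suc s) p y∈)
smallest⊆ (suc s) (inside  ∷ p) here       = here
smallest⊆ (suc s) (inside  ∷ p) (there y∈) = there (smallest⊆ s p y∈)

∣smallest∣ : ∀ {n} s (p : Subset n) → s ≤ ∣ p ∣ → ∣ smallest s p ∣ ≡ s
∣smallest∣ {n} zero p _ = ∣⊥∣≡0 n
∣smallest∣ (suc s) (outside ∷ p) s<∣p∣     = ∣smallest∣ (suc s) p s<∣p∣
∣smallest∣ (suc s) (inside  ∷ p) (s≤s s≤∣p∣) = cong suc (∣smallest∣ s p s≤∣p∣)

smallest-keeps : ∀ {n} s (p : Subset n) {x y} → countBelow x p < s → y Fin.≤ x → y ∈ p →
                 y ∈ smallest s p
smallest-keeps (suc s) (inside  ∷ p) {y = zero} _ _ here = here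
smallest-keeps (suc s) (inside  ∷ p) {suc x} {suc y} (s≤s c<s) (s≤s y≤x) (there y∈p) =
  there (smallest-keeps s p c<s y≤x y∈p)
smallest-keeps (suc s) (outside ∷ p) {suc x} {suc y} c<s (s≤s y≤x) (there y∈p) =
  there (smallest-keeps (suc s) p c<s y≤x y∈p)

-- Lexicographic order

FirstDifference : ∀ {n} → Fin n → Subset n → Subset n → Set
FirstDifference x p q = x ∉ p × x ∈ q × AgreeBelow x p q

data _<ₗₑₓ_ : ∀ {n} → Subset n → Subset n → Set where
  here  : ∀ {n} {p q : Subset n} → (outside ∷ p) <ₗₑₓ (inside ∷ q)
  there : ∀ {n b} {p q : Subset n} → p <ₗₑₓ q → (b ∷ p) <ₗₑₓ (b ∷ q)

<ₗₑₓ-asym : ∀ {n} → Asymmetric (_<ₗₑₓ_ {n})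
<ₗₑₓ-asym (there p<q) (there q<p) = <ₗₑₓ-asym p<q q<p

<ₗₑₓ-irrefl : ∀ {n} {p : Subset n} → ¬ (p <ₗₑₓ p)
<ₗₑₓ-irrefl p<p = <ₗₑₓ-asym p<p p<p

<ₗₑₓ⇒firstDifference : ∀ {n} {p q : Subset n} → p <ₗₑₓ q → ∃ λ x → FirstDifference x p q
<ₗₑₓ⇒firstDifference here = zero , (λ ()) , here , (λ _ ())
<ₗₑₓ⇒firstDifference (there p<q) with <ₗₑₓ⇒firstDifference p<q
... | x , x∉p , x∈q , ag = suc x , x∉p ∘ drop-there , there x∈q , agreeBelow-∷ ag

firstDifference⇒<ₗₑₓ : ∀ {n} {p q : Subset n} {x} → FirstDifference x p q → p <ₗₑₓ q
firstDifference⇒<ₗₑₓ {p = inside  ∷ p} {x = zero} (x∉p , _ , _) = ⊥-elim (x∉p here)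
firstDifference⇒<ₗₑₓ {p = outside ∷ p} {inside ∷ q} {zero} _ = here
firstDifference⇒<ₗₑₓ {p = a ∷ p} {b ∷ q} {suc x} (x∉p , there x∈q , ag)
  with agreeBelow-head ag
... | refl = there (firstDifference⇒<ₗₑₓ (x∉p ∘ there , x∈q , agreeBelow-tail ag))

subsets : ∀ n → List (Subset n)
subsets zero    = [ [] ]
subsets (suc n) = map (outside ∷_) (subsets n) ++ map (inside ∷_) (subsets n)

subsets-sorted : ∀ n → AllPairs _<ₗₑₓ_ (subsets n)
subsets-sorted zero    = All.[] AllPairs.∷ AllPairs.[]
subsets-sorted (suc n) = AllPairsP.++⁺ (tail-sorted outside) (tail-sorted inside)
  (AllP.map⁺ (All.universal (λ _ → AllP.map⁺ (All.universal (λ _ → here) _)) _))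
  where
  tail-sorted : ∀ b → AllPairs _<ₗₑₓ_ (map (b ∷_) (subsets n))
  tail-sorted b = AllPairsP.map⁺ (AllPairs.map there (subsets-sorted n))

∈-subsets : ∀ {n} (p : Subset n) → p Mem.∈ subsets n
∈-subsets []            = hereₗ refl
∈-subsets (outside ∷ p) = ∈-++⁺ˡ (∈-map⁺ (outside ∷_) (∈-subsets p))
∈-subsets {suc n} (inside ∷ p) =
  ∈-++⁺ʳ (map (outside ∷_) (subsets n)) (∈-map⁺ (inside ∷_) (∈-subsets p))

AllPairs-lookup : ∀ {A : Set} {R : A → A → Set} {xs : List A} → AllPairs R xs →
                  ∀ {j k} → toℕ j < toℕ k → R (lookup xs j) (lookup xs k)
AllPairs-lookup (Rx AllPairs.∷ _)  {zero}  {suc k} _         = All.lookup Rx (∈-lookup k)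
AllPairs-lookup (_  AllPairs.∷ Rxs) {suc j} {suc k} (s≤s j<k) = AllPairs-lookup Rxs j<k

AllPairs-index-< : ∀ {A : Set} {R : A → A → Set} {xs : List A} → Asymmetric R → AllPairs R xs →
                   ∀ {j k} → R (lookup xs j) (lookup xs k) → toℕ j < toℕ k
AllPairs-index-< asym sorted {j} {k} Rjk with ℕP.<-cmp (toℕ j) (toℕ k)
... | tri< j<k _ _ = j<k
... | tri≈ _ j≡k _ rewrite FinP.toℕ-injective j≡k = ⊥-elim (asym Rjk Rjk)
... | tri> _ _ k<j = ⊥-elim (asym Rjk (AllPairs-lookup sorted k<j))

-- Shelling orders

ExchangeProperty : ∀ {n} → List (Subset n) → Set
ExchangeProperty Fs = ∀ {j k : Fin (length Fs)} → toℕ j < toℕ k →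
  ∃ λ j′ → toℕ j′ < toℕ k × ∃ λ x →
    x ∈ lookup Fs k × x ∉ lookup Fs j × lookup Fs k - x ⊆ lookup Fs j′

exchange⇒shelling : ∀ {n} (Fs : List (Subset n)) → ExchangeProperty Fs → IsShellingOrder Fs
exchange⇒shelling Fs exchange k 1≤k =
  (⊥ , ⊥⊆ , proj₁ (zero-below k 1≤k) , proj₂ (zero-below k 1≤k) , ⊥⊆) , facet-size
  where
  zero-below : ∀ {m} (k : Fin m) → 1 ≤ toℕ k → ∃ λ (j : Fin m) → toℕ j < toℕ k
  zero-below (suc k) _ = zero , s≤s z≤n
  Fk = lookup Fs k
  facet-size : ∀ G → IsFacetOf (Prefix∩ Fs k) G → ∣ G ∣ + 1 ≡ ∣ Fk ∣
  facet-size G ((G⊆Fk , j , j<k , G⊆Fj) , maximal) with exchange j<k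
  ... | j′ , j′<k , x , x∈Fk , x∉Fj , Fk-x⊆Fj′ = begin
    ∣ G ∣ + 1        ≡⟨ ℕP.+-comm ∣ G ∣ 1 ⟩
    suc ∣ G ∣        ≡⟨ cong (suc ∘ ∣_∣) (sym Fk-x≡G) ⟩
    suc ∣ Fk - x ∣   ≡⟨ sym (x∈p⇒∣p∣≡1+∣p-x∣ x∈Fk) ⟩
    ∣ Fk ∣           ∎
    where
    open ≡-Reasoning
    G⊆Fk-x : G ⊆ Fk - x
    G⊆Fk-x z∈G = x∈p∧x≢y⇒x∈p-y (G⊆Fk z∈G) λ { refl → x∉Fj (G⊆Fj z∈G) }
    Fk-x≡G : Fk - x ≡ G
    Fk-x≡G = maximal (Fk - x) (p─q⊆p Fk ⁅ x ⁆ , j′ , j′<k , Fk-x⊆Fj′) G⊆Fk-x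

facets-of-generated : ∀ {n} {P : Subset n → Set} → (∀ {F G} → P F → P G → F ⊆ G → F ≡ G) →
                      ∀ F → IsFacetOf (Generated P) F ⇔ P F
facets-of-generated {P = P} antichain F = mk⇔ facet⇒P P⇒facet
  where
  facet⇒P : IsFacetOf (Generated P) F → P F
  facet⇒P ((H , PH , F⊆H) , maximal) = subst P (maximal H (H , PH , ⊆-refl) F⊆H) PH
  P⇒facet : P F → IsFacetOf (Generated P) F
  P⇒facet PF = (F , PF , ⊆-refl) , maximal
    where
    maximal : ∀ G → Generated P G → F ⊆ G → G ≡ F
    maximal G (H , PH , G⊆H) F⊆G with antichain PF PH (G⊆H ∘ F⊆G)
    ... | refl = ⊆-antisym G⊆H F⊆G

-- The complex Δ

module OrderedPartition {n r} {E : Fin r → Subset n} (partition : IsOrderedPartition E) where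

  private
    nonempty = proj₁ partition
    covering = proj₁ (proj₂ partition)
    disjoint = proj₁ (proj₂ (proj₂ partition))
    consecutive-ordered = proj₂ (proj₂ (proj₂ partition))

  block : Fin n → Fin r
  block x = proj₁ (covering x)

  ∈-block : ∀ x → x ∈ E (block x)
  ∈-block x = proj₂ (covering x)

  block-unique : ∀ {x i} → x ∈ E i → i ≡ block x
  block-unique x∈Ei = disjoint _ _ _ x∈Ei (∈-block _)

  -- The order is carried across the gap through a point of each (nonempty) block in between.
  blocks-ordered : ∀ {i j : Fin r} → toℕ i < toℕ j → ∀ {x y} → x ∈ E i → y ∈ E j → x Fin.< y
  blocks-ordered {i} {j} i<j with ℕP.m≤n⇒∃[o]m+o≡n i<j
  ... | gap , i+gap≡j = across gap i+gap≡j
    where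
    across : ∀ gap {i j : Fin r} → suc (toℕ i) + gap ≡ toℕ j →
             ∀ {x y} → x ∈ E i → y ∈ E j → x Fin.< y
    across zero {i} {j} i+1≡j =
      consecutive-ordered i j (trans (sym i+1≡j) (ℕP.+-identityʳ _)) _ _
    across (suc gap) {i} {j} i+gap≡j x∈Ei y∈Ej =
      FinP.<-trans (consecutive-ordered i i′ toℕ-i′ _ _ x∈Ei (proj₂ (nonempty i′)))
                   (across gap i′+gap≡j (proj₂ (nonempty i′)) y∈Ej)
      where
      i+2+gap≡j : suc (suc (toℕ i)) + gap ≡ toℕ j
      i+2+gap≡j = trans (sym (ℕP.+-suc (suc (toℕ i)) gap)) i+gap≡j
      i+1<r : suc (toℕ i) < r
      i+1<r = ℕP.≤-trans (ℕP.≤-trans (ℕP.m≤m+n _ gap) (ℕP.≤-reflexive i+2+gap≡j))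
                         (ℕP.<⇒≤ (FinP.toℕ<n j))
      i′ : Fin r
      i′ = Fin.fromℕ< i+1<r
      toℕ-i′ : toℕ i′ ≡ suc (toℕ i)
      toℕ-i′ = FinP.toℕ-fromℕ< i+1<r
      i′+gap≡j : suc (toℕ i′) + gap ≡ toℕ j
      i′+gap≡j = trans (cong (λ t → suc t + gap) toℕ-i′) i+2+gap≡j

  block-mono : ∀ {x y} → x Fin.≤ y → block x Fin.≤ block y
  block-mono {x} {y} x≤y =
    ℕP.≮⇒≥ λ bx>by → ℕP.<⇒≱ (blocks-ordered bx>by (∈-block y) (∈-block x)) x≤y

isMinOfComplement? : ∀ {n} (F : Subset n) x → Dec (IsMinOfComplement F x)
isMinOfComplement? F x = ¬? (x ∈? F) ×-dec FinP.all? (λ y → (y Fin.<? x) →-dec (y ∈? F))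

isDeltaFacet? : ∀ {n r} (E : Fin r → Subset n) (f : Fin r → ℕ) F → Dec (IsDeltaFacet E f F)
isDeltaFacet? {n} E f F =
  FinP.all? (λ i → ∣ E i ∩ ∁ F ∣ ℕ.≤? 1) ×-dec
  FinP.any? (λ x → ¬? (x ∈? F)) ×-dec
  FinP.all? (λ x → FinP.all? λ i →
    isMinOfComplement? F x →-dec (x ∈? E i) →-dec (∣ F ∣ + f i ℕ.≟ n))

module DeltaFacets {n r} {E : Fin r → Subset n} (partition : IsOrderedPartition E)
                   {f : Fin r → ℕ} (f-mono : ∀ i j → i Fin.≤ j → f i ≤ f j) where

  open OrderedPartition partition

  ∣∁F∣≡f : ∀ {F m} → IsDeltaFacet E f F → IsMinOfComplement F m → ∣ ∁ F ∣ ≡ f (block m)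
  ∣∁F∣≡f {F} {m} (_ , _ , size) min-m = ℕP.+-cancelˡ-≡ ∣ F ∣ _ _
    (trans (∣p∣+∣∁p∣≡n F) (sym (size m (block m) min-m (∈-block m))))

  Δ-facets-antichain : ∀ {F G} → IsDeltaFacet E f F → IsDeltaFacet E f G → F ⊆ G → F ≡ G
  Δ-facets-antichain {F} {G} F-facet G-facet F⊆G
    with minOfComplement-exists (proj₁ (proj₂ F-facet))
       | minOfComplement-exists (proj₁ (proj₂ G-facet))
  ... | mF , min-F | mG , min-G =
    p⊆q∧∣q∣≤∣p∣⇒p≡q F⊆G (∣∁p∣≤∣∁q∣⇒∣q∣≤∣p∣ F G (begin
      ∣ ∁ F ∣        ≡⟨ ∣∁F∣≡f F-facet min-F ⟩
      f (block mF)   ≤⟨ f-mono _ _ (block-mono (minOfComplement-≤ min-F (proj₁ min-G ∘ F⊆G))) ⟩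
      f (block mG)   ≡⟨ sym (∣∁F∣≡f G-facet min-G) ⟩
      ∣ ∁ G ∣        ∎))
    where open ℕP.≤-Reasoning

  Δ-facet-from-complement : ∀ {T m} → (∀ i → ∣ E i ∩ T ∣ ≤ 1) →
                            m ∈ T → (∀ y → y Fin.< m → y ∉ T) → ∣ T ∣ ≡ f (block m) →
                            IsDeltaFacet E f (∁ T)
  Δ-facet-from-complement {T} {m} one-per-block m∈T below-m ∣T∣≡f =
    (λ i → subst (λ q → ∣ E i ∩ q ∣ ≤ 1) (sym (∁-involutive T)) (one-per-block i)) ,
    (m , x∈p⇒x∉∁p m∈T) ,
    size
    where
    min-m : IsMinOfComplement (∁ T) m
    min-m = x∈p⇒x∉∁p m∈T , λ y y<m → x∉p⇒x∈∁p (below-m y y<m)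
    size : ∀ x i → IsMinOfComplement (∁ T) x → x ∈ E i → ∣ ∁ T ∣ + f i ≡ n
    size x i min-x x∈Ei with minOfComplement-unique min-x min-m | block-unique x∈Ei
    ... | refl | refl = begin
      ∣ ∁ T ∣ + f (block x)   ≡⟨ cong (∣ ∁ T ∣ +_) (sym ∣T∣≡f) ⟩
      ∣ ∁ T ∣ + ∣ T ∣         ≡⟨ ℕP.+-comm ∣ ∁ T ∣ ∣ T ∣ ⟩
      ∣ T ∣ + ∣ ∁ T ∣         ≡⟨ ∣p∣+∣∁p∣≡n T ⟩
      n                       ∎
      where open ≡-Reasoning

  module Exchange {Fj Fk} (Fj-facet : IsDeltaFacet E f Fj) (Fk-facet : IsDeltaFacet E f Fk)
                  {x} (x∉Fj : x ∉ Fj) (x∈Fk : x ∈ Fk) (Fj≈Fk : AgreeBelow x Fj Fk) where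

    b : Fin r
    b = block x

    Q : Subset n
    Q = (∁ Fk ─ E b) ∪ ⁅ x ⁆

    s : ℕ
    s = ∣ ∁ Fj ∣

    T : Subset n
    T = smallest s Q

    G : Subset n
    G = ∁ T

    ∈Q⁻ : ∀ {y} → y ∈ Q → (y ∉ Fk × y ∉ E b) ⊎ y ≡ x
    ∈Q⁻ y∈Q with x∈p∪q⁻ (∁ Fk ─ E b) ⁅ x ⁆ y∈Q
    ... | inj₁ y∈D = inj₁ (x∈∁p⇒x∉p (p─q⊆p (∁ Fk) (E b) y∈D) , x∈p─q⇒x∉q y∈D)
    ... | inj₂ y∈⁅x⁆ = inj₂ (x∈⁅y⁆⇒x≡y x y∈⁅x⁆)

    ∈Q⁺ : ∀ {y} → y ∉ Fk → y ∉ E b → y ∈ Q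
    ∈Q⁺ y∉Fk y∉Eb = x∈p∪q⁺ (inj₁ (x∈p∧x∉q⇒x∈p─q (x∉p⇒x∈∁p y∉Fk) y∉Eb))

    x∈Q : x ∈ Q
    x∈Q = x∈p∪q⁺ (inj₂ (x∈⁅x⁆ x))

    -- ∁ Fj meets E b only in x, so deleting E b from ∁ Fk changes nothing below x.
    Q≈∁Fj : AgreeBelow x Q (∁ Fj)
    Q≈∁Fj y y<x = mk⇔ Q⇒∁Fj ∁Fj⇒Q
      where
      Q⇒∁Fj : y ∈ Q → y ∈ ∁ Fj
      Q⇒∁Fj y∈Q with ∈Q⁻ y∈Q
      ... | inj₁ (y∉Fk , _) = x∉p⇒x∈∁p (y∉Fk ∘ to (Fj≈Fk y y<x))
      ... | inj₂ y≡x        = ⊥-elim (FinP.<⇒≢ y<x y≡x)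
      ∁Fj⇒Q : y ∈ ∁ Fj → y ∈ Q
      ∁Fj⇒Q y∈∁Fj = ∈Q⁺ (x∈∁p⇒x∉p y∈∁Fj ∘ from (Fj≈Fk y y<x)) λ y∈Eb →
        FinP.<⇒≢ y<x (∣p∣≤1⇒x≡y (proj₁ Fj-facet b)
          (x∈p∩q⁺ (y∈Eb , y∈∁Fj)) (x∈p∩q⁺ (∈-block x , x∉p⇒x∈∁p x∉Fj)))

    mj : Fin n
    mj = proj₁ (minOfComplement-exists (x , x∉Fj))

    min-mj : IsMinOfComplement Fj mj
    min-mj = proj₂ (minOfComplement-exists (x , x∉Fj))

    mk : Fin n
    mk = proj₁ (minOfComplement-exists (proj₁ (proj₂ Fk-facet)))

    min-mk : IsMinOfComplement Fk mk
    min-mk = proj₂ (minOfComplement-exists (proj₁ (proj₂ Fk-facet)))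

    mj≤x : mj Fin.≤ x
    mj≤x = minOfComplement-≤ min-mj x∉Fj

    mj≤mk : mj Fin.≤ mk
    mj≤mk = ℕP.≮⇒≥ λ mk<mj → proj₁ min-mk
      (to (Fj≈Fk _ (ℕP.<-≤-trans mk<mj mj≤x)) (proj₂ min-mj _ mk<mj))

    ∣∁Fk∣≤∣Q∣ : ∣ ∁ Fk ∣ ≤ ∣ Q ∣
    ∣∁Fk∣≤∣Q∣ = begin
      ∣ ∁ Fk ∣                         ≡⟨ ∣p∣≡∣p∩q∣+∣p─q∣ (∁ Fk) (E b) ⟩
      ∣ ∁ Fk ∩ E b ∣ + ∣ ∁ Fk ─ E b ∣   ≤⟨ ℕP.+-monoˡ-≤ _ ∣∁Fk∩Eb∣≤1 ⟩
      suc ∣ ∁ Fk ─ E b ∣               ≤⟨ s≤s (p⊆q⇒∣p∣≤∣q∣ ∁Fk─Eb⊆Q-x) ⟩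
      suc ∣ Q - x ∣                    ≡⟨ sym (x∈p⇒∣p∣≡1+∣p-x∣ x∈Q) ⟩
      ∣ Q ∣                            ∎
      where
      open ℕP.≤-Reasoning
      ∣∁Fk∩Eb∣≤1 : ∣ ∁ Fk ∩ E b ∣ ≤ 1
      ∣∁Fk∩Eb∣≤1 = subst (λ q → ∣ q ∣ ≤ 1) (∩-comm (E b) (∁ Fk)) (proj₁ Fk-facet b)
      ∁Fk─Eb⊆Q-x : ∁ Fk ─ E b ⊆ Q - x
      ∁Fk─Eb⊆Q-x y∈ = x∈p∧x≢y⇒x∈p-y (p⊆p∪q ⁅ x ⁆ y∈)
        λ { refl → x∈∁p⇒x∉p (p─q⊆p (∁ Fk) (E b) y∈) x∈Fk }

    s≤∣Q∣ : s ≤ ∣ Q ∣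
    s≤∣Q∣ = begin
      ∣ ∁ Fj ∣       ≡⟨ ∣∁F∣≡f Fj-facet min-mj ⟩
      f (block mj)   ≤⟨ f-mono _ _ (block-mono mj≤mk) ⟩
      f (block mk)   ≡⟨ sym (∣∁F∣≡f Fk-facet min-mk) ⟩
      ∣ ∁ Fk ∣       ≤⟨ ∣∁Fk∣≤∣Q∣ ⟩
      ∣ Q ∣          ∎
      where open ℕP.≤-Reasoning

    -- Fewer than s elements of Q lie below x, so T contains every element of Q up to x.
    ∈T⁺ : ∀ {y} → y Fin.≤ x → y ∈ Q → y ∈ T
    ∈T⁺ = smallest-keeps s Q (subst (_< s) (sym (countBelow-cong Q≈∁Fj))
                                    (countBelow<∣p∣ (x∉p⇒x∈∁p x∉Fj)))

    x∈T : x ∈ T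
    x∈T = ∈T⁺ ℕP.≤-refl x∈Q

    T≈∁Fj : AgreeBelow x T (∁ Fj)
    T≈∁Fj y y<x = mk⇔ (to (Q≈∁Fj y y<x) ∘ smallest⊆ s Q)
                      (∈T⁺ (ℕP.<⇒≤ y<x) ∘ from (Q≈∁Fj y y<x))

    one-per-block : ∀ i → ∣ E i ∩ T ∣ ≤ 1
    one-per-block i with i FinP.≟ b
    ... | yes refl = ℕP.≤-trans (p⊆q⇒∣p∣≤∣q∣ Eb∩T⊆⁅x⁆) (ℕP.≤-reflexive (∣⁅x⁆∣≡1 x))
      where
      Eb∩T⊆⁅x⁆ : E b ∩ T ⊆ ⁅ x ⁆
      Eb∩T⊆⁅x⁆ y∈ with x∈p∩q⁻ (E b) T y∈
      ... | y∈Eb , y∈T with ∈Q⁻ (smallest⊆ s Q y∈T)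
      ...   | inj₁ (_ , y∉Eb) = ⊥-elim (y∉Eb y∈Eb)
      ...   | inj₂ refl       = x∈⁅x⁆ x
    ... | no i≢b = ℕP.≤-trans (p⊆q⇒∣p∣≤∣q∣ Ei∩T⊆Ei∩∁Fk) (proj₁ Fk-facet i)
      where
      Ei∩T⊆Ei∩∁Fk : E i ∩ T ⊆ E i ∩ ∁ Fk
      Ei∩T⊆Ei∩∁Fk y∈ with x∈p∩q⁻ (E i) T y∈
      ... | y∈Ei , y∈T with ∈Q⁻ (smallest⊆ s Q y∈T)
      ...   | inj₁ (y∉Fk , _) = x∈p∩q⁺ (y∈Ei , x∉p⇒x∈∁p y∉Fk)
      ...   | inj₂ refl       = ⊥-elim (i≢b (block-unique y∈Ei))

    mj∈T : mj ∈ T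
    mj∈T with ℕP.m≤n⇒m<n∨m≡n mj≤x
    ... | inj₁ mj<x = from (T≈∁Fj _ mj<x) (x∉p⇒x∈∁p (proj₁ min-mj))
    ... | inj₂ mj≡x = subst (_∈ T) (sym (FinP.toℕ-injective mj≡x)) x∈T

    below-mj : ∀ y → y Fin.< mj → y ∉ T
    below-mj y y<mj y∈T =
      x∈∁p⇒x∉p (to (T≈∁Fj y (ℕP.<-≤-trans y<mj mj≤x)) y∈T) (proj₂ min-mj y y<mj)

    G-facet : IsDeltaFacet E f G
    G-facet = Δ-facet-from-complement one-per-block mj∈T below-mj
                (trans (∣smallest∣ s Q s≤∣Q∣) (∣∁F∣≡f Fj-facet min-mj))

    G<Fk : G <ₗₑₓ Fk
    G<Fk = firstDifference⇒<ₗₑₓ (x∈p⇒x∉∁p x∈T , x∈Fk , G≈Fk)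
      where
      G≈Fk : AgreeBelow x G Fk
      G≈Fk y y<x = mk⇔
        (λ y∈G → to (Fj≈Fk y y<x) (x∉∁p⇒x∈p (x∈∁p⇒x∉p y∈G ∘ from (T≈∁Fj y y<x))))
        (λ y∈Fk → x∉p⇒x∈∁p (x∈p⇒x∉∁p (from (Fj≈Fk y y<x) y∈Fk) ∘ to (T≈∁Fj y y<x)))

    Fk-x⊆G : Fk - x ⊆ G
    Fk-x⊆G {z} z∈Fk-x = x∉p⇒x∈∁p (z∉Q ∘ smallest⊆ s Q)
      where
      z∉Q : z ∉ Q
      z∉Q z∈Q with ∈Q⁻ z∈Q
      ... | inj₁ (z∉Fk , _) = z∉Fk (p─q⊆p Fk ⁅ x ⁆ z∈Fk-x)
      ... | inj₂ refl       = x∈p─q⇒x∉q z∈Fk-x (x∈⁅x⁆ x)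

    exchange : ∃ λ G → IsDeltaFacet E f G × G <ₗₑₓ Fk × Fk - x ⊆ G
    exchange = G , G-facet , G<Fk , Fk-x⊆G

  facetList : List (Subset n)
  facetList = filter (isDeltaFacet? E f) (subsets n)

  facetList-sorted : AllPairs _<ₗₑₓ_ facetList
  facetList-sorted = AllPairsP.filter⁺ (isDeltaFacet? E f) (subsets-sorted n)

  ∈-facetList : ∀ {F} → F Mem.∈ facetList ⇔ IsDeltaFacet E f F
  ∈-facetList {F} = mk⇔ (proj₂ ∘ ∈-filter⁻ (isDeltaFacet? E f) {xs = subsets n})
                        (∈-filter⁺ (isDeltaFacet? E f) (∈-subsets F))

  lookup-facetList : ∀ i → IsDeltaFacet E f (lookup facetList i)
  lookup-facetList i = to ∈-facetList (∈-lookup i)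

  facetList-exchange : ExchangeProperty facetList
  facetList-exchange {j} {k} j<k
    with <ₗₑₓ⇒firstDifference (AllPairs-lookup facetList-sorted j<k)
  ... | x , x∉Fj , x∈Fk , Fj≈Fk
    with Exchange.exchange (lookup-facetList j) (lookup-facetList k) x∉Fj x∈Fk Fj≈Fk
  ... | G , G-facet , G<Fk , Fk-x⊆G =
    index G∈ ,
    AllPairs-index-< <ₗₑₓ-asym facetList-sorted (subst (_<ₗₑₓ lookup facetList k) G≡ G<Fk) ,
    x , x∈Fk , x∉Fj , subst (lookup facetList k - x ⊆_) G≡ Fk-x⊆G
    where
    G∈ : G Mem.∈ facetList
    G∈ = from ∈-facetList G-facet
    G≡ : G ≡ lookup facetList (index G∈)
    G≡ = lookup-index G∈

proposition3p2 : (n r : ℕ) (E : Fin r → Subset n) → IsOrderedPartition E →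
    (f : Fin r → ℕ) → (∀ i → 2 ≤ f i) → (∀ i j → i Data.Fin.≤ j → f i ≤ f j) →
    Shellable (Δ E f)
proposition3p2 n r E partition f _ f-mono =
  facetList ,
  AllPairs.map (λ F<G F≡G → <ₗₑₓ-irrefl (subst (_<ₗₑₓ _) F≡G F<G)) facetList-sorted ,
  (λ F → ⇔.trans ∈-facetList (⇔.sym (facets-of-generated Δ-facets-antichain F))) ,
  exchange⇒shelling facetList facetList-exchange
  where open DeltaFacets partition f-mono
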